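{- Let $(d_n)_{n\ge 0}$ be the period-doubling sequence, defined by $d_{2n}=1$, $d_{4n+1}=0$, $d_{4n+3}=d_n$ for all $n\ge 0$. Then the running sum $\mathrm{sum}_{\mathrm{pd}}(n)=\sum_{i=0}^{n} d_i$ is not $2$-synchronised.
   Context: A function $f:\mathbb{N}\to\mathbb{N}$ is $2$-synchronised if there is a finite automaton which, reading the base-$2$ representations of $n$ and $m$ in parallel (most significant digit first, the shorter padded with leading zeros), accepts exactly the pairs $(n,m)$ with $m = f(n)$. -}

module Defs where

open import Data.Nat using (ℕ; zero; suc; _+_; _^_; _<_; _≤_; _%_; _/_; _≡ᵇ_)
open import Data.Bool using (Bool; true; false)
open import Data.Fin using (Fin)
open import Data.List using (List; []; _∷_; reverse; zip; foldl)
open import Data.Product using (Σ; _×_; _,_)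
open import Relation.Binary.PropositionalEquality using (_≡_)

runningSum : (ℕ → ℕ) → ℕ → ℕ
runningSum d zero    = d zero
runningSum d (suc n) = runningSum d n + d (suc n)

lsbDigits : ℕ → ℕ → List Bool
lsbDigits zero    n = []
lsbDigits (suc L) n = (n % 2 ≡ᵇ 1) ∷ lsbDigits L (n / 2)

msbDigits : ℕ → ℕ → List Bool
msbDigits L n = reverse (lsbDigits L n)

-- L is the common length of the base-2 representations of n and m after
-- padding the shorter with leading zeros: the least L with n < 2^L and m < 2^L
-- (so 0 is represented by the empty word).
IsPadLength : ℕ → ℕ → ℕ → Set
IsPadLength L n m =
  (n < 2 ^ L) × (m < 2 ^ L) × (∀ L′ → n < 2 ^ L′ → m < 2 ^ L′ → L ≤ L′)

record DFA : Set where
  field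
    size   : ℕ
    start  : Fin size
    δ      : Fin size → Bool × Bool → Fin size
    final  : Fin size → Bool

accepts : DFA → List (Bool × Bool) → Bool
accepts A w = DFA.final A (foldl (DFA.δ A) (DFA.start A) w)

pairWord : ℕ → ℕ → ℕ → List (Bool × Bool)
pairWord L n m = zip (msbDigits L n) (msbDigits L m)

Synchronised₂ : (ℕ → ℕ) → Set
Synchronised₂ f =
  Σ DFA λ A → ∀ n m L → IsPadLength L n m →
    (accepts A (pairWord L n m) ≡ true → m ≡ f n) ×
    (m ≡ f n → accepts A (pairWord L n m) ≡ true)

{-# OPTIONS --safe #-}

-- Let n_K be the number written (10)^K in binary.  Grouping the running sum s in fours,
-- d(4t) + d(4t+1) + d(4t+2) + d(4t+3) = 2 + d(t), gives 3·s(n_K) + K = 2·n_K + 3.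
-- Read the pair (n_K, s(n_K)) as K two-letter blocks; once K exceeds the number of states, the
-- automaton is in the same state at two block boundaries, so the b ≥ 1 blocks in between can be
-- deleted or repeated.  On each track the values x₀, x₁, x₂ of the three words satisfy
-- x₂ + T·x₀ = x₁ + T·x₁ with T = 4^b.  Since K is an affine function of the two tracks, the block
-- counts K₁ − b, K₁, K₁ + b satisfy the same relation, which forces b = T·b: a contradiction.

module Submission where

open import Defs
open import Data.Nat using (ℕ; _+_; _*_)
open import Relation.Binary.PropositionalEquality using (_≡_)
open import Relation.Nullary using (¬_)

open import Data.Bool using (Bool; true; false)
open import Data.Fin using (Fin; toℕ)
open import Data.Fin.Properties using (pigeonhole; toℕ≤pred[n])
open import Data.List using (List; []; _∷_; _++_; length; map; reverse; zip; foldl; take; drop; concatMap)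
open import Data.List.Properties
open import Data.Nat using (zero; suc; _∸_; _⊓_; _^_; _<_; _≤_; _%_; _/_; _≡ᵇ_; z≤n; s≤s; _<?_)
open import Data.Nat.DivMod
open import Data.Nat.Divisibility using (divides)
open import Data.Nat.Properties
open import Data.Nat.Tactic.RingSolver using (solve-∀)
open import Data.Product using (_×_; _,_; proj₁; proj₂; ∃-syntax)
open import Function using (_∘_)
open import Function.Bundles using (_⇔_; mk⇔; Equivalence)
open import Relation.Binary.PropositionalEquality using (refl; sym; trans; cong; cong₂; subst; module ≡-Reasoning)
open import Relation.Nullary using (yes; no; contradiction)

open ≡-Reasoning

-- Binary values

bit : Bool → ℕ
bit false = 0
bit true  = 1

valˡ : List Bool → ℕ
valˡ []      = 0
valˡ (b ∷ w) = bit b + valˡ w * 2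

val : List Bool → ℕ
val w = valˡ (reverse w)

bit-parity : ∀ b n → ((bit b + n * 2) % 2 ≡ᵇ 1) ≡ b
bit-parity false n = cong (_≡ᵇ 1) (m*n%n≡0 n 2)
bit-parity true  n = cong (_≡ᵇ 1) ([m+kn]%n≡m%n 1 n 2)

bit-half : ∀ b n → (bit b + n * 2) / 2 ≡ n
bit-half false n = m*n/n≡m n 2
bit-half true  n = trans (+-distrib-/-∣ʳ 1 {n * 2} {2} (divides n refl)) (m*n/n≡m n 2)

bit[m%2≡ᵇ1]≡m%2 : ∀ m → bit (m % 2 ≡ᵇ 1) ≡ m % 2
bit[m%2≡ᵇ1]≡m%2 m with m % 2 | m%n<n m 2
... | 0           | _ = refl
... | 1           | _ = refl
... | suc (suc _) | s≤s (s≤s ())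

lsbDigits-valˡ : ∀ w → lsbDigits (length w) (valˡ w) ≡ w
lsbDigits-valˡ []      = refl
lsbDigits-valˡ (b ∷ w) = cong₂ _∷_ (bit-parity b (valˡ w))
  (trans (cong (lsbDigits (length w)) (bit-half b (valˡ w))) (lsbDigits-valˡ w))

valˡ-lsbDigits : ∀ L m → m < 2 ^ L → valˡ (lsbDigits L m) ≡ m
valˡ-lsbDigits zero    m m<1 = sym (n<1⇒n≡0 m<1)
valˡ-lsbDigits (suc L) m m<2^1+L = begin
  bit (m % 2 ≡ᵇ 1) + valˡ (lsbDigits L (m / 2)) * 2
    ≡⟨ cong₂ (λ r q → r + q * 2) (bit[m%2≡ᵇ1]≡m%2 m) (valˡ-lsbDigits L (m / 2) half<2^L) ⟩
  m % 2 + m / 2 * 2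
    ≡⟨ sym (m≡m%n+[m/n]*n m 2) ⟩
  m ∎
  where
  half<2^L : m / 2 < 2 ^ L
  half<2^L = m<n*o⇒m/o<n (subst (m <_) (*-comm 2 (2 ^ L)) m<2^1+L)

length-msbDigits : ∀ L m → length (msbDigits L m) ≡ L
length-msbDigits L m = trans (length-reverse (lsbDigits L m)) (length-lsb L m)
  where
  length-lsb : ∀ L m → length (lsbDigits L m) ≡ L
  length-lsb zero    m = refl
  length-lsb (suc L) m = cong suc (length-lsb L (m / 2))

msbDigits-val : ∀ w → msbDigits (length w) (val w) ≡ w
msbDigits-val w = begin
  reverse (lsbDigits (length w) (valˡ (reverse w)))
    ≡⟨ cong (λ L → reverse (lsbDigits L (valˡ (reverse w)))) (sym (length-reverse w)) ⟩
  reverse (lsbDigits (length (reverse w)) (valˡ (reverse w)))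
    ≡⟨ cong reverse (lsbDigits-valˡ (reverse w)) ⟩
  reverse (reverse w)
    ≡⟨ reverse-involutive w ⟩
  w ∎

val-msbDigits : ∀ L m → m < 2 ^ L → val (msbDigits L m) ≡ m
val-msbDigits L m m<2^L =
  trans (cong valˡ (reverse-involutive (lsbDigits L m))) (valˡ-lsbDigits L m m<2^L)

valˡ-++ : ∀ u w → valˡ (u ++ w) ≡ valˡ u + 2 ^ length u * valˡ w
valˡ-++ []      w = sym (+-identityʳ (valˡ w))
valˡ-++ (b ∷ u) w = begin
  bit b + valˡ (u ++ w) * 2                    ≡⟨ cong (λ x → bit b + x * 2) (valˡ-++ u w) ⟩
  bit b + (valˡ u + 2 ^ length u * valˡ w) * 2 ≡⟨ distrib (bit b) (valˡ u) (2 ^ length u) (valˡ w) ⟩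
  bit b + valˡ u * 2 + 2 * 2 ^ length u * valˡ w ∎
  where
  distrib : ∀ x y t z → x + (y + t * z) * 2 ≡ x + y * 2 + 2 * t * z
  distrib = solve-∀

val-++ : ∀ u w → val (u ++ w) ≡ val u * 2 ^ length w + val w
val-++ u w = begin
  valˡ (reverse (u ++ w))                                  ≡⟨ cong valˡ (reverse-++ u w) ⟩
  valˡ (reverse w ++ reverse u)                            ≡⟨ valˡ-++ (reverse w) (reverse u) ⟩
  val w + 2 ^ length (reverse w) * val u                   ≡⟨ cong (λ L → val w + 2 ^ L * val u) (length-reverse w) ⟩
  val w + 2 ^ length w * val u                             ≡⟨ +-comm (val w) _ ⟩
  2 ^ length w * val u + val w                             ≡⟨ cong (_+ val w) (*-comm (2 ^ length w) (val u)) ⟩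
  val u * 2 ^ length w + val w                             ∎

valˡ-< : ∀ w → valˡ w < 2 ^ length w
valˡ-< []      = s≤s z≤n
valˡ-< (b ∷ w) = ≤-trans (s≤s (+-monoˡ-≤ (valˡ w * 2) (bit≤1 b)))
  (≤-trans (*-monoˡ-≤ 2 (valˡ-< w)) (≤-reflexive (*-comm (2 ^ length w) 2)))
  where
  bit≤1 : ∀ b → bit b ≤ 1
  bit≤1 false = z≤n
  bit≤1 true  = s≤s z≤n

val-< : ∀ w → val w < 2 ^ length w
val-< w = subst (λ L → val w < 2 ^ L) (length-reverse w) (valˡ-< (reverse w))

isPadLength-leading-one : ∀ u m → m < 2 ^ length (true ∷ u) →
  IsPadLength (length (true ∷ u)) (val (true ∷ u)) m
isPadLength-leading-one u m m<2^L = val-< (true ∷ u) , m<2^L , minimal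
  where
  2^|u|≤val : 2 ^ length u ≤ val (true ∷ u)
  2^|u|≤val = ≤-trans (≤-trans (≤-reflexive (sym (*-identityˡ (2 ^ length u)))) (m≤m+n _ (val u)))
                      (≤-reflexive (sym (val-++ (true ∷ []) u)))
  minimal : ∀ L′ → val (true ∷ u) < 2 ^ L′ → m < 2 ^ L′ → length (true ∷ u) ≤ L′
  minimal L′ val<2^L′ _ with length u <? L′
  ... | yes |u|<L′ = |u|<L′
  ... | no  |u|≮L′ = contradiction val<2^L′
                       (≤⇒≯ (≤-trans (^-monoʳ-≤ 2 (≮⇒≥ |u|≮L′)) 2^|u|≤val))

-- Two-track words

zip-tracks : ∀ {A B : Set} (w : List (A × B)) → zip (map proj₁ w) (map proj₂ w) ≡ w
zip-tracks []      = refl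
zip-tracks (p ∷ w) = cong (p ∷_) (zip-tracks w)

pairWord-tracks : ∀ w → pairWord (length w) (val (map proj₁ w)) (val (map proj₂ w)) ≡ w
pairWord-tracks w = trans (cong₂ zip (msbDigits-val-track proj₁) (msbDigits-val-track proj₂)) (zip-tracks w)
  where
  msbDigits-val-track : (π : Bool × Bool → Bool) → msbDigits (length w) (val (map π w)) ≡ map π w
  msbDigits-val-track π =
    trans (cong (λ L → msbDigits L (val (map π w))) (sym (length-map π w))) (msbDigits-val (map π w))

accepts⇔graph : ∀ {f} (S : Synchronised₂ f) w →
  IsPadLength (length w) (val (map proj₁ w)) (val (map proj₂ w)) →
  accepts (proj₁ S) w ≡ true ⇔ val (map proj₂ w) ≡ f (val (map proj₁ w))
accepts⇔graph (A , sync) w pad = mk⇔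
  (λ acc → proj₁ (sync _ _ _ pad) (subst Accepted (sym (pairWord-tracks w)) acc))
  (λ eq → subst Accepted (pairWord-tracks w) (proj₂ (sync _ _ _ pad) eq))
  where
  Accepted : List (Bool × Bool) → Set
  Accepted u = accepts A u ≡ true

-- Loops in finite automata

module _ {B : Set} {Q : ℕ} (δ : Fin Q → B → Fin Q) where

  foldl-loop : ∀ {p} ys → foldl δ p ys ≡ p → ∀ zs → foldl δ p (ys ++ zs) ≡ foldl δ p zs
  foldl-loop {p} ys loop zs = trans (foldl-++ δ p ys zs) (cong (λ q → foldl δ q zs) loop)

  loop-decomposition : ∀ q (bs : List B) → Q < length bs →
    ∃[ xs ] ∃[ ys ] ∃[ zs ] bs ≡ xs ++ ys ++ zs × 0 < length ys × foldl δ (foldl δ q xs) ys ≡ foldl δ q xs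
  loop-decomposition q bs Q<|bs|
    with i , j , i<j , same-state ← pigeonhole (n<1+n Q) (λ j → foldl δ q (take (toℕ j) bs))
    = take i′ bs , ys , drop j′ bs , split , 0<|ys| , loop
    where
    i′ j′ : ℕ
    i′ = toℕ i
    j′ = toℕ j
    ys : List B
    ys = drop i′ (take j′ bs)
    j′<|bs| : j′ < length bs
    j′<|bs| = ≤-<-trans (toℕ≤pred[n] j) Q<|bs|
    prefix : take j′ bs ≡ take i′ bs ++ ys
    prefix = begin
      take j′ bs                              ≡⟨ take++drop≡id i′ (take j′ bs) ⟨
      take i′ (take j′ bs) ++ ys              ≡⟨ cong (_++ ys) (take-take i′ j′ bs) ⟩
      take (i′ ⊓ j′) bs ++ ys                 ≡⟨ cong (λ n → take n bs ++ ys) (m≤n⇒m⊓n≡m (<⇒≤ i<j)) ⟩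
      take i′ bs ++ ys                        ∎
    split : bs ≡ take i′ bs ++ ys ++ drop j′ bs
    split = begin
      bs                                      ≡⟨ take++drop≡id j′ bs ⟨
      take j′ bs ++ drop j′ bs                ≡⟨ cong (_++ drop j′ bs) prefix ⟩
      (take i′ bs ++ ys) ++ drop j′ bs        ≡⟨ ++-assoc (take i′ bs) ys (drop j′ bs) ⟩
      take i′ bs ++ ys ++ drop j′ bs          ∎
    0<|ys| : 0 < length ys
    0<|ys| = subst (0 <_) (sym (trans (length-drop i′ (take j′ bs))
               (cong (_∸ i′) (trans (length-take j′ bs) (m≤n⇒m⊓n≡m (<⇒≤ j′<|bs|))))))
               (m<n⇒0<n∸m i<j)
    loop : foldl δ (foldl δ q (take i′ bs)) ys ≡ foldl δ q (take i′ bs)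
    loop = begin
      foldl δ (foldl δ q (take i′ bs)) ys     ≡⟨ foldl-++ δ q (take i′ bs) ys ⟨
      foldl δ q (take i′ bs ++ ys)            ≡⟨ cong (foldl δ q) prefix ⟨
      foldl δ q (take j′ bs)                  ≡⟨ same-state ⟨
      foldl δ q (take i′ bs)                  ∎

module _ {B : Set} (A : DFA) (g : B → List (Bool × Bool)) where
  open DFA A

  private
    step : Fin size → B → Fin size
    step p c = foldl δ p (g c)

    run : List B → Fin size
    run = foldl step start

    foldl-concatMap : ∀ q cs → foldl δ q (concatMap g cs) ≡ foldl step q cs
    foldl-concatMap q []       = refl
    foldl-concatMap q (c ∷ cs) = trans (foldl-++ δ q (g c) (concatMap g cs)) (foldl-concatMap (step q c) cs)

    accepts-concatMap : ∀ cs → accepts A (concatMap g cs) ≡ final (run cs)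
    accepts-concatMap cs = cong final (foldl-concatMap start cs)

  block-pumping : ∀ cs → size < length cs → accepts A (concatMap g cs) ≡ true →
    ∃[ xs ] ∃[ ys ] ∃[ zs ] 0 < length ys ×
      accepts A (concatMap g (xs ++ zs)) ≡ true ×
      accepts A (concatMap g (xs ++ ys ++ zs)) ≡ true ×
      accepts A (concatMap g (xs ++ ys ++ ys ++ zs)) ≡ true
  block-pumping cs size<|cs| acc
    with xs , ys , zs , refl , 0<|ys| , loop ← loop-decomposition step start cs size<|cs|
    = xs , ys , zs , 0<|ys|
    , same-run (xs ++ zs) (sym (skip-loop zs)) , acc , same-run (xs ++ ys ++ ys ++ zs) (skip-loop (ys ++ zs))
    where
    skip-loop : ∀ rest → run (xs ++ ys ++ rest) ≡ run (xs ++ rest)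
    skip-loop rest = begin
      run (xs ++ ys ++ rest)                ≡⟨ foldl-++ step start xs (ys ++ rest) ⟩
      foldl step (run xs) (ys ++ rest)      ≡⟨ foldl-loop step ys loop rest ⟩
      foldl step (run xs) rest              ≡⟨ foldl-++ step start xs rest ⟨
      run (xs ++ rest)                      ∎
    same-run : ∀ cs′ → run cs′ ≡ run (xs ++ ys ++ zs) → accepts A (concatMap g cs′) ≡ true
    same-run cs′ same = begin
      accepts A (concatMap g cs′)           ≡⟨ accepts-concatMap cs′ ⟩
      final (run cs′)                       ≡⟨ cong final same ⟩
      final (run (xs ++ ys ++ zs))          ≡⟨ accepts-concatMap (xs ++ ys ++ zs) ⟨
      accepts A (concatMap g (xs ++ ys ++ zs)) ≡⟨ acc ⟩
      true                                  ∎

-- The pumping relation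

-- A record rather than an equation, so that unification can read T and the xᵢ off the type.
record Pumped (T x₀ x₁ x₂ : ℕ) : Set where
  constructor pumped
  field
    equation : x₂ + T * x₀ ≡ x₁ + T * x₁

val-pumped : ∀ u y z → Pumped (2 ^ length y) (val (u ++ z)) (val (u ++ y ++ z)) (val (u ++ y ++ y ++ z))
val-pumped u y z
  rewrite val-++ u (y ++ y ++ z) | val-++ u (y ++ z) | val-++ u z | val-++ y (y ++ z) | val-++ y z
        | length-++ y {y ++ z} | length-++ y {z}
        | ^-distribˡ-+-* 2 (length y) (length y + length z) | ^-distribˡ-+-* 2 (length y) (length z)
  = pumped (identity (val u) (val y) (val z) (2 ^ length y) (2 ^ length z))
  where
  identity : ∀ U Y Z T S →
    U * (T * (T * S)) + (Y * (T * S) + (Y * S + Z)) + T * (U * S + Z)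
      ≡ U * (T * S) + (Y * S + Z) + T * (U * (T * S) + (Y * S + Z))
  identity = solve-∀

val-hom-pumped : ∀ {B : Set} (h : List B → List Bool) → (∀ xs ys → h (xs ++ ys) ≡ h xs ++ h ys) →
  ∀ xs ys zs →
  Pumped (2 ^ length (h ys)) (val (h (xs ++ zs))) (val (h (xs ++ ys ++ zs))) (val (h (xs ++ ys ++ ys ++ zs)))
val-hom-pumped h h-++ xs ys zs
  rewrite h-++ xs (ys ++ ys ++ zs) | h-++ ys (ys ++ zs) | h-++ xs (ys ++ zs) | h-++ ys zs | h-++ xs zs
  = val-pumped (h xs) (h ys) (h zs)

pumped-affine : ∀ {T} α β γ {n₀ n₁ n₂ m₀ m₁ m₂ K₀ K₁ K₂} → Pumped T n₀ n₁ n₂ → Pumped T m₀ m₁ m₂ →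
  α * m₀ + K₀ ≡ β * n₀ + γ → α * m₁ + K₁ ≡ β * n₁ + γ → α * m₂ + K₂ ≡ β * n₂ + γ →
  Pumped T K₀ K₁ K₂
pumped-affine {T} α β γ {n₀} {n₁} {n₂} {m₀} {m₁} {m₂} {K₀} {K₁} {K₂} (pumped pn) (pumped pm) e₀ e₁ e₂ =
  pumped (+-cancelˡ-≡ (α * (m₂ + T * m₀)) _ _ (begin
    α * (m₂ + T * m₀) + (K₂ + T * K₀) ≡⟨ regroup α T m₀ m₂ K₀ K₂ ⟩
    (α * m₂ + K₂) + T * (α * m₀ + K₀) ≡⟨ cong₂ (λ x y → x + T * y) e₂ e₀ ⟩
    (β * n₂ + γ) + T * (β * n₀ + γ)   ≡⟨ regroup β T n₀ n₂ γ γ ⟨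
    β * (n₂ + T * n₀) + (γ + T * γ)   ≡⟨ cong (λ x → β * x + (γ + T * γ)) pn ⟩
    β * (n₁ + T * n₁) + (γ + T * γ)   ≡⟨ regroup β T n₁ n₁ γ γ ⟩
    (β * n₁ + γ) + T * (β * n₁ + γ)   ≡⟨ cong₂ (λ x y → x + T * y) e₁ e₁ ⟨
    (α * m₁ + K₁) + T * (α * m₁ + K₁) ≡⟨ regroup α T m₁ m₁ K₁ K₁ ⟨
    α * (m₁ + T * m₁) + (K₁ + T * K₁) ≡⟨ cong (λ x → α * x + (K₁ + T * K₁)) pm ⟨
    α * (m₂ + T * m₀) + (K₁ + T * K₁) ∎))
  where
  regroup : ∀ a T x₀ x₂ y₀ y₂ → a * (x₂ + T * x₀) + (y₂ + T * y₀) ≡ (a * x₂ + y₂) + T * (a * x₀ + y₀)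
  regroup = solve-∀

¬pumped-progression : ∀ {T} a b c → 2 ≤ T → 0 < b → ¬ Pumped T (a + c) (a + (b + c)) (a + (b + (b + c)))
¬pumped-progression {T} a b c 2≤T 0<b (pumped equation) = <-irrefl b≡T*b (<-≤-trans b<2*b (*-monoˡ-≤ b 2≤T))
  where
  rest : ℕ
  rest = a + b + c + T * (a + c)
  lhs : ∀ a b c T → a + (b + (b + c)) + T * (a + c) ≡ b + (a + b + c + T * (a + c))
  lhs = solve-∀
  rhs : ∀ a b c T → a + (b + c) + T * (a + (b + c)) ≡ T * b + (a + b + c + T * (a + c))
  rhs = solve-∀
  b≡T*b : b ≡ T * b
  b≡T*b = +-cancelʳ-≡ rest b (T * b) (trans (sym (lhs a b c T)) (trans equation (rhs a b c T)))
  b<2*b : b < 2 * b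
  b<2*b = subst (b <_) (cong (b +_) (sym (+-identityʳ b))) (m<m+n b 0<b)

¬length-pumped : ∀ {B : Set} {T} (xs ys zs : List B) → 2 ≤ T → 0 < length ys →
  ¬ Pumped T (length (xs ++ zs)) (length (xs ++ ys ++ zs)) (length (xs ++ ys ++ ys ++ zs))
¬length-pumped xs ys zs
  rewrite length-++ xs {ys ++ ys ++ zs} | length-++ ys {ys ++ zs} | length-++ xs {ys ++ zs}
        | length-++ ys {zs} | length-++ xs {zs}
  = ¬pumped-progression (length xs) (length ys) (length zs)

-- Words made of blocks (1,x)(0,y)

block : Bool × Bool → List (Bool × Bool)
block (x , y) = (true , x) ∷ (false , y) ∷ []

flatten : List (Bool × Bool) → List (Bool × Bool)
flatten = concatMap block

alternating : ℕ → List Bool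
alternating zero    = []
alternating (suc k) = true ∷ false ∷ alternating k

top-flatten : ∀ cs → map proj₁ (flatten cs) ≡ alternating (length cs)
top-flatten []       = refl
top-flatten (c ∷ cs) = cong (λ u → true ∷ false ∷ u) (top-flatten cs)

length-alternating : ∀ k → length (alternating k) ≡ k * 2
length-alternating zero    = refl
length-alternating (suc k) = cong (λ n → suc (suc n)) (length-alternating k)

alternating-suc : ∀ K → alternating (suc K) ≡ alternating K ++ true ∷ false ∷ []
alternating-suc zero    = refl
alternating-suc (suc K) = cong (λ u → true ∷ false ∷ u) (alternating-suc K)

val-alternating-suc : ∀ K → val (alternating (suc K)) ≡ 2 + val (alternating K) * 4
val-alternating-suc K =
  trans (cong val (alternating-suc K))
    (trans (val-++ (alternating K) (true ∷ false ∷ [])) (+-comm (val (alternating K) * 4) 2))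

bottom-flatten-surjective : ∀ k w → length w ≡ k * 2 → ∃[ cs ] length cs ≡ k × map proj₂ (flatten cs) ≡ w
bottom-flatten-surjective zero    []          _     = [] , refl , refl
bottom-flatten-surjective (suc k) (x ∷ y ∷ w) |w|≡
  with bottom-flatten-surjective k w (suc-injective (suc-injective |w|≡))
... | cs , |cs|≡k , bottom≡w = (x , y) ∷ cs , cong suc |cs|≡k , cong (λ u → x ∷ y ∷ u) bottom≡w

isPadLength-flatten : ∀ cs →
  IsPadLength (length (flatten cs)) (val (map proj₁ (flatten cs))) (val (map proj₂ (flatten cs)))
isPadLength-flatten []       = s≤s z≤n , s≤s z≤n , λ _ _ _ → z≤n
isPadLength-flatten (c ∷ cs) =
  subst (λ L → IsPadLength L (val top) (val bottom)) (length-map proj₁ w)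
    (isPadLength-leading-one (drop 1 top) (val bottom) bottom<2^L)
  where
  w : List (Bool × Bool)
  w = flatten (c ∷ cs)
  top bottom : List Bool
  top = map proj₁ w
  bottom = map proj₂ w
  bottom<2^L : val bottom < 2 ^ length top
  bottom<2^L = subst (λ L → val bottom < 2 ^ L)
    (trans (length-map proj₂ w) (sym (length-map proj₁ w))) (val-< bottom)

val-track-pumped : ∀ (π : Bool × Bool → Bool) xs ys zs →
  Pumped (2 ^ length (flatten ys)) (val (map π (flatten (xs ++ zs))))
         (val (map π (flatten (xs ++ ys ++ zs)))) (val (map π (flatten (xs ++ ys ++ ys ++ zs))))
val-track-pumped π xs ys zs =
  subst (λ L → Pumped (2 ^ L) (track (xs ++ zs)) (track (xs ++ ys ++ zs)) (track (xs ++ ys ++ ys ++ zs)))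
    (length-map π (flatten ys)) (val-hom-pumped (map π ∘ flatten) track-++ xs ys zs)
  where
  track : List (Bool × Bool) → ℕ
  track cs = val (map π (flatten cs))
  track-++ : ∀ xs ys → map π (flatten (xs ++ ys)) ≡ map π (flatten xs) ++ map π (flatten ys)
  track-++ xs ys = trans (cong (map π) (concatMap-++ block xs ys)) (map-++ π (flatten xs) (flatten ys))

2≤2^length-flatten : ∀ ys → 0 < length ys → 2 ≤ 2 ^ length (flatten ys)
2≤2^length-flatten (y ∷ ys) _ = ^-monoʳ-≤ 2 {1} {length (flatten (y ∷ ys))} (s≤s z≤n)

-- The period-doubling sequence

module PeriodDoubling (d : ℕ → ℕ)
  (d-even : ∀ n → d (2 * n) ≡ 1) (d-4n+1 : ∀ n → d (4 * n + 1) ≡ 0) (d-4n+3 : ∀ n → d (4 * n + 3) ≡ d n) where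

  private
    s : ℕ → ℕ
    s = runningSum d

  d[4t] : ∀ t → d (t * 4) ≡ 1
  d[4t] t = trans (cong d (reshape t)) (d-even (t * 2))
    where
    reshape : ∀ t → t * 4 ≡ 2 * (t * 2)
    reshape = solve-∀

  d[4t+1] : ∀ t → d (1 + t * 4) ≡ 0
  d[4t+1] t = trans (cong d (reshape t)) (d-4n+1 t)
    where
    reshape : ∀ t → 1 + t * 4 ≡ 4 * t + 1
    reshape = solve-∀

  d[4t+2] : ∀ t → d (2 + t * 4) ≡ 1
  d[4t+2] t = trans (cong d (reshape t)) (d-even (1 + t * 2))
    where
    reshape : ∀ t → 2 + t * 4 ≡ 2 * (1 + t * 2)
    reshape = solve-∀

  d[4t+3] : ∀ t → d (3 + t * 4) ≡ d t
  d[4t+3] t = trans (cong d (reshape t)) (d-4n+3 t)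
    where
    reshape : ∀ t → 3 + t * 4 ≡ 4 * t + 3
    reshape = solve-∀

  sum-d[4t…4t+3] : ∀ x t → x + d (t * 4) + d (1 + t * 4) + d (2 + t * 4) + d (3 + t * 4) ≡ x + 1 + 0 + 1 + d t
  sum-d[4t…4t+3] x t = cong₂ _+_ (cong₂ _+_ (cong₂ _+_ (cong (x +_) (d[4t] t)) (d[4t+1] t)) (d[4t+2] t)) (d[4t+3] t)

  runningSum-[3+4t] : ∀ t → s (3 + t * 4) ≡ suc t * 2 + s t
  runningSum-[3+4t] zero    = sum-d[4t…4t+3] 0 0
  runningSum-[3+4t] (suc t) = begin
    s (3 + t * 4) + d (suc t * 4) + d (1 + suc t * 4) + d (2 + suc t * 4) + d (3 + suc t * 4)
      ≡⟨ sum-d[4t…4t+3] (s (3 + t * 4)) (suc t) ⟩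
    s (3 + t * 4) + 1 + 0 + 1 + d (suc t)
      ≡⟨ cong (λ x → x + 1 + 0 + 1 + d (suc t)) (runningSum-[3+4t] t) ⟩
    suc t * 2 + s t + 1 + 0 + 1 + d (suc t)
      ≡⟨ regroup t (s t) (d (suc t)) ⟩
    suc (suc t) * 2 + (s t + d (suc t)) ∎
    where
    regroup : ∀ t σ δ → suc t * 2 + σ + 1 + 0 + 1 + δ ≡ suc (suc t) * 2 + (σ + δ)
    regroup = solve-∀

  runningSum-[2+4t] : ∀ t → d t ≡ 1 → s (2 + t * 4) ≡ 1 + t * 2 + s t
  runningSum-[2+4t] t dt≡1 = +-cancelʳ-≡ 1 _ _ (begin
    s (2 + t * 4) + 1          ≡⟨ cong (s (2 + t * 4) +_) (trans (d[4t+3] t) dt≡1) ⟨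
    s (3 + t * 4)              ≡⟨ runningSum-[3+4t] t ⟩
    suc t * 2 + s t            ≡⟨ regroup t (s t) ⟩
    1 + t * 2 + s t + 1        ∎)
    where
    regroup : ∀ t σ → suc t * 2 + σ ≡ 1 + t * 2 + σ + 1
    regroup = solve-∀

  d-alternating : ∀ K → d (val (alternating K)) ≡ 1
  d-alternating zero    = d[4t] 0
  d-alternating (suc K) = trans (cong d (val-alternating-suc K)) (d[4t+2] (val (alternating K)))

  runningSum-alternating : ∀ K → 3 * s (val (alternating K)) + K ≡ 2 * val (alternating K) + 3
  runningSum-alternating zero    = cong (λ x → 3 * x + 0) (d[4t] 0)
  runningSum-alternating (suc K) = begin
    3 * s (val (alternating (suc K))) + suc K ≡⟨ cong (λ n → 3 * s n + suc K) (val-alternating-suc K) ⟩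
    3 * s (2 + t * 4) + suc K                  ≡⟨ cong (λ x → 3 * x + suc K) (runningSum-[2+4t] t (d-alternating K)) ⟩
    3 * (1 + t * 2 + s t) + suc K              ≡⟨ regroup t (s t) K ⟩
    (3 * s t + K) + (4 + t * 6)                ≡⟨ cong (_+ (4 + t * 6)) (runningSum-alternating K) ⟩
    (2 * t + 3) + (4 + t * 6)                  ≡⟨ collect t ⟩
    2 * (2 + t * 4) + 3                        ≡⟨ cong (λ n → 2 * n + 3) (val-alternating-suc K) ⟨
    2 * val (alternating (suc K)) + 3          ∎
    where
    t : ℕ
    t = val (alternating K)
    regroup : ∀ t σ K → 3 * (1 + t * 2 + σ) + suc K ≡ (3 * σ + K) + (4 + t * 6)
    regroup = solve-∀
    collect : ∀ t → (2 * t + 3) + (4 + t * 6) ≡ 2 * (2 + t * 4) + 3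
    collect = solve-∀

  runningSum-alternating-≤ : ∀ K → 3 ≤ K → s (val (alternating K)) ≤ val (alternating K)
  runningSum-alternating-≤ K 3≤K = *-cancelˡ-≤ 3 (≤-trans 3s≤2n (*-monoˡ-≤ n {2} {3} (s≤s (s≤s z≤n))))
    where
    n : ℕ
    n = val (alternating K)
    3s≤2n : 3 * s n ≤ 2 * n
    3s≤2n = +-cancelʳ-≤ 3 (3 * s n) (2 * n)
              (≤-trans (+-monoʳ-≤ (3 * s n) 3≤K) (≤-reflexive (runningSum-alternating K)))

module PeriodDoublingAutomaton (d : ℕ → ℕ)
  (d-even : ∀ n → d (2 * n) ≡ 1) (d-4n+1 : ∀ n → d (4 * n + 1) ≡ 0) (d-4n+3 : ∀ n → d (4 * n + 3) ≡ d n)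
  (S : Synchronised₂ (runningSum d)) where

  open PeriodDoubling d d-even d-4n+1 d-4n+3

  private
    A : DFA
    A = proj₁ S

    accepts-flatten⇔graph : ∀ cs →
      accepts A (flatten cs) ≡ true ⇔ val (map proj₂ (flatten cs)) ≡ runningSum d (val (map proj₁ (flatten cs)))
    accepts-flatten⇔graph cs = accepts⇔graph S (flatten cs) (isPadLength-flatten cs)

    k : ℕ
    k = 3 + DFA.size A

    m : ℕ
    m = runningSum d (val (alternating k))

    m<2^[k*2] : m < 2 ^ (k * 2)
    m<2^[k*2] = ≤-<-trans (runningSum-alternating-≤ k (m≤m+n 3 (DFA.size A)))
      (subst (λ L → val (alternating k) < 2 ^ L) (length-alternating k) (val-< (alternating k)))

  long-accepted-word : ∃[ cs ] DFA.size A < length cs × accepts A (flatten cs) ≡ true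
  long-accepted-word
    with cs , |cs|≡k , bottom≡digits ← bottom-flatten-surjective k (msbDigits (k * 2) m) (length-msbDigits (k * 2) m)
    = cs , subst (DFA.size A <_) (sym |cs|≡k) (m<n+m (DFA.size A) (s≤s z≤n))
         , Equivalence.from (accepts-flatten⇔graph cs) (begin
      val (map proj₂ (flatten cs))                  ≡⟨ cong val bottom≡digits ⟩
      val (msbDigits (k * 2) m)                     ≡⟨ val-msbDigits (k * 2) m m<2^[k*2] ⟩
      m                                             ≡⟨ cong (λ K → runningSum d (val (alternating K))) |cs|≡k ⟨
      runningSum d (val (alternating (length cs)))  ≡⟨ cong (runningSum d ∘ val) (top-flatten cs) ⟨
      runningSum d (val (map proj₁ (flatten cs)))   ∎)

  accepted⇒affine : ∀ cs → accepts A (flatten cs) ≡ true →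
    3 * val (map proj₂ (flatten cs)) + length cs ≡ 2 * val (map proj₁ (flatten cs)) + 3
  accepted⇒affine cs acc = begin
    3 * val (map proj₂ (flatten cs)) + length cs
      ≡⟨ cong (λ x → 3 * x + length cs) (Equivalence.to (accepts-flatten⇔graph cs) acc) ⟩
    3 * runningSum d (val (map proj₁ (flatten cs))) + length cs
      ≡⟨ cong (λ u → 3 * runningSum d (val u) + length cs) (top-flatten cs) ⟩
    3 * runningSum d (val (alternating (length cs))) + length cs
      ≡⟨ runningSum-alternating (length cs) ⟩
    2 * val (alternating (length cs)) + 3
      ≡⟨ cong (λ u → 2 * val u + 3) (top-flatten cs) ⟨
    2 * val (map proj₁ (flatten cs)) + 3 ∎

  pumped-words-not-all-accepted : ∀ xs ys zs → 0 < length ys →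
    accepts A (flatten (xs ++ zs)) ≡ true → accepts A (flatten (xs ++ ys ++ zs)) ≡ true →
    ¬ accepts A (flatten (xs ++ ys ++ ys ++ zs)) ≡ true
  pumped-words-not-all-accepted xs ys zs 0<|ys| acc₀ acc₁ acc₂ =
    ¬length-pumped xs ys zs (2≤2^length-flatten ys 0<|ys|) 0<|ys|
      (pumped-affine 3 2 3 (val-track-pumped proj₁ xs ys zs) (val-track-pumped proj₂ xs ys zs)
        (accepted⇒affine (xs ++ zs) acc₀) (accepted⇒affine (xs ++ ys ++ zs) acc₁)
        (accepted⇒affine (xs ++ ys ++ ys ++ zs) acc₂))

mainTheorem4 : (d : ℕ → ℕ) →
    (∀ n → d (2 * n) ≡ 1) →
    (∀ n → d (4 * n + 1) ≡ 0) →
    (∀ n → d (4 * n + 3) ≡ d n) →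
    ¬ Synchronised₂ (runningSum d)
mainTheorem4 d d-even d-4n+1 d-4n+3 S =
  let open PeriodDoublingAutomaton d d-even d-4n+1 d-4n+3 S
      (cs , size<|cs| , acc) = long-accepted-word
      (xs , ys , zs , 0<|ys| , acc₀ , acc₁ , acc₂) = block-pumping (proj₁ S) block cs size<|cs| acc
  in pumped-words-not-all-accepted xs ys zs 0<|ys| acc₀ acc₁ acc₂
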